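{- Let $M$ be a matroid, and for a matroid $N$ let $\mathcal{Z}(N)$ denote its set of cyclic flats, $\mathcal{Z}'(N)$ its set of nonempty proper cyclic flats, $\eta_N(Y)=|Y|-r_N(Y)$ the nullity of a set $Y$, and $\eta(\mathcal{Z}'(N))=\sum_{F\in\mathcal{Z}'(N)}\eta_N(F)$. (1) Let $x$ be an element of $M$. If $F\in\mathcal{Z}(M\backslash x)$, then $\mathrm{cl}_M(F)\in\mathcal{Z}(M)$. If $\mathrm{cl}_M(F)=F$, then $\eta_{M\backslash x}(F)=\eta_M(F)$; if $\mathrm{cl}_M(F)=F\cup x$, then $\eta_{M\backslash x}(F)=\eta_M(F\cup x)-1$. (2) Let $y$ be an element of $M$. If $F\in\mathcal{Z}(M/y)$, then exactly one of $F$ and $F\cup y$ is in $\mathcal{Z}(M)$. The nullity of $F$ in $M/y$ equals the nullity in $M$ of whichever of $F$, $F\cup y$ lies in $\mathcal{Z}(M)$, unless $y$ is a loop of $M$, in which case $\eta_{M/y}(F)=\eta_M(F\cup y)-1$. (3) Consequently, if $N$ is a minor of $M$, then $\eta(\mathcal{Z}'(N))\le\eta(\mathcal{Z}'(M))$.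
   Context: All matroids are finite. A cyclic set of a matroid is a (possibly empty) union of circuits; a cyclic flat is a flat that is a cyclic set. -}

module Defs where

open import Data.Nat using (ℕ; zero; suc; _+_; _∸_; _≤_; _<_; _≟_; _<?_)
open import Data.Bool using (Bool; true; false; if_then_else_)
import Data.Bool as B
open import Data.Fin using (Fin)
open import Data.Fin.Subset
  using (Subset; ⁅_⁆; _∈_; _∉_; _⊆_; _∪_; _∩_; _-_; ∣_∣)
  renaming (⊥ to ∅)
open import Data.Fin.Subset.Properties using (_∈?_; _⊆?_; anySubset?)
open import Data.Fin.Properties using (all?)
open import Data.Vec using (Vec; []; _∷_)
open import Data.Vec.Properties using (≡-dec)
open import Data.Product using (Σ; ∃; _×_; _,_)
open import Relation.Nullary using (Dec; yes; no; ¬_; does)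
open import Relation.Nullary.Decidable using (_×-dec_; _→-dec_; ¬?)
open import Relation.Binary.PropositionalEquality using (_≡_; _≢_; refl)

-- A (candidate) matroid on a ground set E ⊆ Fin n, given by its rank
-- function.  Only the values of r on subsets of E are meaningful.

record RankFn (n : ℕ) : Set where
  constructor mkRankFn
  field
    E : Subset n
    r : Subset n → ℕ

open RankFn public

record IsMatroid {n : ℕ} (M : RankFn n) : Set where
  field
    r-bound  : ∀ X → X ⊆ E M → r M X ≤ ∣ X ∣
    r-mono   : ∀ X Y → Y ⊆ E M → X ⊆ Y → r M X ≤ r M Y
    r-submod : ∀ X Y → X ⊆ E M → Y ⊆ E M →
               r M (X ∪ Y) + r M (X ∩ Y) ≤ r M X + r M Y

_＼_ : ∀ {n} → RankFn n → Fin n → RankFn n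
M ＼ x = mkRankFn (E M - x) (r M)

_／_ : ∀ {n} → RankFn n → Fin n → RankFn n
M ／ y = mkRankFn (E M - y) (λ X → r M (X ∪ ⁅ y ⁆) ∸ r M ⁅ y ⁆)

_≅_ : ∀ {n} → RankFn n → RankFn n → Set
N ≅ M = (E N ≡ E M) × (∀ X → X ⊆ E N → r N X ≡ r M X)

data _≼_ {n : ℕ} (N : RankFn n) : RankFn n → Set where
  minor-refl : ∀ {M} → N ≅ M → N ≼ M
  minor-del  : ∀ {M} x → x ∈ E M → N ≼ (M ＼ x) → N ≼ M
  minor-con  : ∀ {M} y → y ∈ E M → N ≼ (M ／ y) → N ≼ M

module _ {n : ℕ} (M : RankFn n) where

  η : Subset n → ℕ
  η Y = ∣ Y ∣ ∸ r M Y

  cl : Subset n → Subset n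
  cl X = Data.Vec.tabulate λ e →
    does (e ∈? E M) B.∧ does (r M (X ∪ ⁅ e ⁆) ≟ r M X)

  IsLoop : Fin n → Set
  IsLoop y = (y ∈ E M) × (r M ⁅ y ⁆ ≡ 0)

  IsIndependent : Subset n → Set
  IsIndependent I = r M I ≡ ∣ I ∣

  IsCircuit : Subset n → Set
  IsCircuit C = (C ⊆ E M) × (r M C < ∣ C ∣) ×
                (∀ D → D ⊆ C → D ≢ C → IsIndependent D)

  -- cyclic set: a (possibly empty) union of circuits, i.e. every element
  -- of X lies in a circuit contained in X
  IsCyclic : Subset n → Set
  IsCyclic X = ∀ e → e ∈ X → ∃ λ C → IsCircuit C × e ∈ C × C ⊆ X

  IsFlat : Subset n → Set
  IsFlat X = (X ⊆ E M) × (∀ e → e ∈ E M → e ∉ X → r M X < r M (X ∪ ⁅ e ⁆))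

  IsCyclicFlat : Subset n → Set
  IsCyclicFlat X = IsFlat X × IsCyclic X

  IsCyclicFlat′ : Subset n → Set
  IsCyclicFlat′ X = IsCyclicFlat X × (X ≢ ∅) × (X ≢ E M)

private
  _≟ₛ_ : ∀ {n} (X Y : Subset n) → Dec (X ≡ Y)
  _≟ₛ_ = ≡-dec B._≟_

  allSubsets? : ∀ {n} {P : Subset n → Set} → (∀ X → Dec (P X)) → Dec (∀ X → P X)
  allSubsets? {P = P} P? with anySubset? (λ X → ¬? (P? X))
  ... | yes (X , ¬PX) = no λ ∀P → ¬PX (∀P X)
  ... | no ¬∃ = yes λ X → helper X (P? X)
    where
      helper : ∀ X → Dec (P X) → P X
      helper X (yes p) = p
      helper X (no ¬p) = Data.Empty.⊥-elim (¬∃ (X , ¬p))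
        where import Data.Empty

module _ {n : ℕ} (M : RankFn n) where

  isCircuit? : ∀ C → Dec (IsCircuit M C)
  isCircuit? C = (C ⊆? E M) ×-dec (r M C <? ∣ C ∣) ×-dec
    allSubsets? (λ D → (D ⊆? C) →-dec ((¬? (D ≟ₛ C)) →-dec (r M D ≟ ∣ D ∣)))

  isCyclic? : ∀ X → Dec (IsCyclic M X)
  isCyclic? X = all? λ e → (e ∈? X) →-dec
    anySubset? (λ C → isCircuit? C ×-dec (e ∈? C) ×-dec (C ⊆? X))

  isFlat? : ∀ X → Dec (IsFlat M X)
  isFlat? X = (X ⊆? E M) ×-dec all? (λ e → (e ∈? E M) →-dec
    ((¬? (e ∈? X)) →-dec (r M X <? r M (X ∪ ⁅ e ⁆))))

  isCyclicFlat′? : ∀ X → Dec (IsCyclicFlat′ M X)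
  isCyclicFlat′? X = (isFlat? X ×-dec isCyclic? X) ×-dec
    ¬? (X ≟ₛ ∅) ×-dec ¬? (X ≟ₛ E M)

sumSubsets : ∀ {n} → (Subset n → ℕ) → ℕ
sumSubsets {zero}  f = f []
sumSubsets {suc n} f = sumSubsets (λ X → f (false ∷ X)) + sumSubsets (λ X → f (true ∷ X))

ηZ′ : ∀ {n} → RankFn n → ℕ
ηZ′ M = sumSubsets λ F → if does (isCyclicFlat′? M F) then η M F else 0

-- Everything is reduced to rank computations.  The central general fact is
-- the rank characterisation of cyclic sets: X ⊆ E is cyclic iff
-- r(X - f) = r(X) for every f ∈ X (one direction by submodularity against a
-- circuit through f, the other by the fundamental-circuit lemma, proved by
-- shrinking X one element at a time).  A cyclic flat F of M ＼ z or M ／ z is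
-- then analysed according as z is spanned by F: if it is, F ∪ z is a cyclic
-- flat of M, otherwise F is.  For deletion this set is cl_M(F); for
-- contraction F and F ∪ y are never both cyclic flats of M.  Part (3) pairs each F ∌ z with F ∪ z
-- in the sum defining η(Z′(·)): every nonempty proper cyclic flat of the
-- one-element minor lifts to one of M of no smaller nullity, and induction
-- along the sequence of deletions and contractions finishes the proof.

module Submission where

open import Defs
open import Data.Nat using (ℕ; zero; suc; _+_; _∸_; _≤_; _<_; _≟_; z≤n; s≤s)
open import Data.Nat.Properties
  using (≤-trans; ≤-refl; ≤-reflexive; ≤-antisym; ≤-pred; <-≤-trans; ≤-<-trans;
         <⇒≱; ≤∧≢⇒<; +-comm; +-mono-≤; +-monoˡ-<; +-cancelʳ-≤; +-cancelˡ-<;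
         m≤m+n; m≤n+m; n<1+n; n≤0⇒n≡0; +-∸-comm; m∸n+n≡m; ∸-monoˡ-≤; ∸-cancelʳ-≡;
         m≤n+o⇒m∸n≤o; n≢0⇒n>0; ≰⇒>; ≤⇒≯; 1+n≢n; +-identityʳ; +-commutativeSemigroup; module ≤-Reasoning)
open import Data.Bool using (true; if_then_else_)
import Data.Bool as B
open import Data.Fin using (Fin; zero; suc)
open import Data.Fin.Properties using (any?) renaming (_≟_ to _≟ᶠ_)
open import Data.Fin.Subset
  using (Subset; ⁅_⁆; _∈_; _∉_; _⊆_; _∪_; _∩_; _─_; _-_; ∣_∣; inside; outside)
  renaming (⊥ to ∅)
open import Data.Fin.Subset.Properties
  using (_∈?_; x∈⁅x⁆; x∈⁅y⁆⇒x≡y; p⊆p∪q; q⊆p∪q; x∈p∪q⁺; x∈p∪q⁻; x∈p∩q⁺; x∈p∩q⁻;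
         p─q⊆p; x∈p∧x≢y⇒x∈p-y; x∈p⇒∣p-x∣<∣p∣; ⊆-refl; ⊆-reflexive; ⊆-trans; ⊆-antisym;
         ∣⁅x⁆∣≡1; ∣⊥∣≡0; ∉⊥; nonempty?; Empty-unique;
         p∩q⊆p; ∪-assoc; ∪-comm; ∪-idem; ∪-identityʳ; ∪-distribʳ-∩)
open import Data.Vec using ([]; _∷_; here; there; lookup)
open import Data.Vec.Properties using (lookup∘tabulate; []=⇒lookup; lookup⇒[]=)
open import Data.Product using (∃; _×_; _,_; proj₁; proj₂)
open import Data.Sum using (_⊎_; inj₁; inj₂; [_,_]′)
open import Relation.Nullary using (Dec; yes; no; ¬_; does; contradiction)
open import Relation.Nullary.Decidable using (_×-dec_; ¬?; decidable-stable; dec-true)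
open import Relation.Binary.PropositionalEquality
open import Function using (_∘_)
open import Algebra.Properties.CommutativeSemigroup +-commutativeSemigroup using (interchange)

e∈X∪⁅e⁆ : ∀ {n} (X : Subset n) e → e ∈ X ∪ ⁅ e ⁆
e∈X∪⁅e⁆ X e = x∈p∪q⁺ (inj₂ (x∈⁅x⁆ e))

∈-∪⁅⁆⁻ : ∀ {n} {X : Subset n} {e i} → i ∈ X ∪ ⁅ e ⁆ → i ≢ e → i ∈ X
∈-∪⁅⁆⁻ {X = X} i∈ i≢e with x∈p∪q⁻ X _ i∈
... | inj₁ i∈X = i∈X
... | inj₂ i∈e = contradiction (x∈⁅y⁆⇒x≡y _ i∈e) i≢e

x∈p─q⇒x∉q : ∀ {n} (p q : Subset n) {i} → i ∈ p ─ q → i ∉ q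
x∈p─q⇒x∉q (_ ∷ p) (outside ∷ q) here ()
x∈p─q⇒x∉q (_ ∷ p) (_ ∷ q) (there i∈) (there i∈q) = x∈p─q⇒x∉q p q i∈ i∈q

∈-remove⁻ : ∀ {n} {X : Subset n} {f i} → i ∈ X - f → i ∈ X × i ≢ f
∈-remove⁻ {X = X} {f} i∈ = p─q⊆p X ⁅ f ⁆ i∈ , λ { refl → x∈p─q⇒x∉q X ⁅ f ⁆ i∈ (x∈⁅x⁆ f) }

f∉X-f : ∀ {n} (X : Subset n) f → f ∉ X - f
f∉X-f X f f∈ = proj₂ (∈-remove⁻ f∈) refl

⁅⁆-⊆ : ∀ {n} {Y : Subset n} {e} → e ∈ Y → ⁅ e ⁆ ⊆ Y
⁅⁆-⊆ {e = e} e∈Y i∈e rewrite x∈⁅y⁆⇒x≡y e i∈e = e∈Y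

∪⁅⁆-⊆ : ∀ {n} {X Y : Subset n} {e} → X ⊆ Y → e ∈ Y → X ∪ ⁅ e ⁆ ⊆ Y
∪⁅⁆-⊆ {X = X} X⊆Y e∈Y i∈ with x∈p∪q⁻ X _ i∈
... | inj₁ i∈X = X⊆Y i∈X
... | inj₂ i∈e = ⁅⁆-⊆ e∈Y i∈e

∪⁅⁆-mono : ∀ {n} {X Y : Subset n} e → X ⊆ Y → X ∪ ⁅ e ⁆ ⊆ Y ∪ ⁅ e ⁆
∪⁅⁆-mono {Y = Y} e X⊆Y = ∪⁅⁆-⊆ (λ i∈ → p⊆p∪q ⁅ e ⁆ (X⊆Y i∈)) (e∈X∪⁅e⁆ Y e)

∪⁅⁆-absorb : ∀ {n} {X : Subset n} {f} → f ∈ X → X ∪ ⁅ f ⁆ ≡ X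
∪⁅⁆-absorb f∈X = ⊆-antisym (∪⁅⁆-⊆ ⊆-refl f∈X) (p⊆p∪q _)

remove-added : ∀ {n} {X : Subset n} {z} → z ∉ X → (X ∪ ⁅ z ⁆) - z ≡ X
remove-added {z = z} z∉X = ⊆-antisym
  (λ i∈ → let (i∈X∪z , i≢z) = ∈-remove⁻ i∈ in ∈-∪⁅⁆⁻ i∈X∪z i≢z)
  (λ i∈X → x∈p∧x≢y⇒x∈p-y (p⊆p∪q _ i∈X) λ { refl → z∉X i∈X })

add-removed : ∀ {n} {X : Subset n} {f} → f ∈ X → (X - f) ∪ ⁅ f ⁆ ≡ X
add-removed {X = X} {f} f∈X = ⊆-antisym (∪⁅⁆-⊆ (p─q⊆p X _) f∈X) from
  where
  from : X ⊆ (X - f) ∪ ⁅ f ⁆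
  from {i} i∈X with i ≟ᶠ f
  ... | yes refl = e∈X∪⁅e⁆ (X - f) f
  ... | no i≢f = p⊆p∪q _ (x∈p∧x≢y⇒x∈p-y i∈X i≢f)

remove-past-added : ∀ {n} {X : Subset n} {z g} → g ≢ z → (X ∪ ⁅ z ⁆) - g ≡ (X - g) ∪ ⁅ z ⁆
remove-past-added {X = X} {z} {g} g≢z = ⊆-antisym to from
  where
  to : (X ∪ ⁅ z ⁆) - g ⊆ (X - g) ∪ ⁅ z ⁆
  to {i} i∈ with ∈-remove⁻ i∈ | i ≟ᶠ z
  ... | _ , _ | yes refl = e∈X∪⁅e⁆ _ z
  ... | i∈X∪z , i≢g | no i≢z = p⊆p∪q _ (x∈p∧x≢y⇒x∈p-y (∈-∪⁅⁆⁻ i∈X∪z i≢z) i≢g)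
  from : (X - g) ∪ ⁅ z ⁆ ⊆ (X ∪ ⁅ z ⁆) - g
  from = ∪⁅⁆-⊆ (λ i∈ → let (i∈X , i≢g) = ∈-remove⁻ i∈ in x∈p∧x≢y⇒x∈p-y (p⊆p∪q _ i∈X) i≢g)
               (x∈p∧x≢y⇒x∈p-y (e∈X∪⁅e⁆ X z) λ z≡g → g≢z (sym z≡g))

remove-∪-sub : ∀ {n} {X Y : Subset n} {g} → Y ⊆ X → g ∈ Y → (X - g) ∪ Y ≡ X
remove-∪-sub {X = X} {Y} {g} Y⊆X g∈Y = ⊆-antisym to from
  where
  to : (X - g) ∪ Y ⊆ X
  to i∈ with x∈p∪q⁻ (X - g) Y i∈
  ... | inj₁ i∈X-g = proj₁ (∈-remove⁻ i∈X-g)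
  ... | inj₂ i∈Y = Y⊆X i∈Y
  from : X ⊆ (X - g) ∪ Y
  from {i} i∈X with i ≟ᶠ g
  ... | yes refl = q⊆p∪q _ Y g∈Y
  ... | no i≢g = p⊆p∪q Y (x∈p∧x≢y⇒x∈p-y i∈X i≢g)

remove-∩-sub : ∀ {n} {X Y : Subset n} {g} → Y ⊆ X → (X - g) ∩ Y ≡ Y - g
remove-∩-sub {X = X} {Y} {g} Y⊆X = ⊆-antisym
  (λ i∈ → let (i∈X-g , i∈Y) = x∈p∩q⁻ (X - g) Y i∈ in x∈p∧x≢y⇒x∈p-y i∈Y (proj₂ (∈-remove⁻ i∈X-g)))
  (λ i∈ → let (i∈Y , i≢g) = ∈-remove⁻ i∈ in x∈p∩q⁺ (x∈p∧x≢y⇒x∈p-y (Y⊆X i∈Y) i≢g , i∈Y))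

∣∪⁅⁆∣ : ∀ {n} (X : Subset n) z → z ∉ X → ∣ X ∪ ⁅ z ⁆ ∣ ≡ suc ∣ X ∣
∣∪⁅⁆∣ (outside ∷ X) zero    _   = cong (λ Y → suc ∣ Y ∣) (∪-identityʳ X)
∣∪⁅⁆∣ (inside  ∷ X) zero    z∉X = contradiction here z∉X
∣∪⁅⁆∣ (outside ∷ X) (suc z) z∉X = ∣∪⁅⁆∣ X z (λ z∈X → z∉X (there z∈X))
∣∪⁅⁆∣ (inside  ∷ X) (suc z) z∉X = cong suc (∣∪⁅⁆∣ X z (λ z∈X → z∉X (there z∈X)))

∣-∣ : ∀ {n} {X : Subset n} {f} → f ∈ X → suc ∣ X - f ∣ ≡ ∣ X ∣
∣-∣ {X = X} {f} f∈X = begin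
  suc ∣ X - f ∣       ≡⟨ sym (∣∪⁅⁆∣ (X - f) f (f∉X-f X f)) ⟩
  ∣ (X - f) ∪ ⁅ f ⁆ ∣  ≡⟨ cong ∣_∣ (add-removed f∈X) ⟩
  ∣ X ∣               ∎
  where open ≡-Reasoning

∪-swapʳ : ∀ {n} (X Y Z : Subset n) → (X ∪ Y) ∪ Z ≡ (X ∪ Z) ∪ Y
∪-swapʳ X Y Z = begin
  (X ∪ Y) ∪ Z   ≡⟨ ∪-assoc X Y Z ⟩
  X ∪ (Y ∪ Z)   ≡⟨ cong (X ∪_) (∪-comm Y Z) ⟩
  X ∪ (Z ∪ Y)   ≡⟨ sym (∪-assoc X Z Y) ⟩
  (X ∪ Z) ∪ Y   ∎
  where open ≡-Reasoning

∪-distribʳ-∪ : ∀ {n} (X Y Z : Subset n) → (X ∪ Z) ∪ (Y ∪ Z) ≡ (X ∪ Y) ∪ Z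
∪-distribʳ-∪ X Y Z = begin
  (X ∪ Z) ∪ (Y ∪ Z)   ≡⟨ sym (∪-assoc (X ∪ Z) Y Z) ⟩
  ((X ∪ Z) ∪ Y) ∪ Z   ≡⟨ cong (_∪ Z) (∪-swapʳ X Z Y) ⟩
  ((X ∪ Y) ∪ Z) ∪ Z   ≡⟨ ∪-assoc (X ∪ Y) Z Z ⟩
  (X ∪ Y) ∪ (Z ∪ Z)   ≡⟨ cong ((X ∪ Y) ∪_) (∪-idem Z) ⟩
  (X ∪ Y) ∪ Z         ∎
  where open ≡-Reasoning

⊆-or-missing : ∀ {n} (D I : Subset n) → I ⊆ D ⊎ ∃ λ g → g ∈ I × g ∉ D
⊆-or-missing D I with any? (λ g → (g ∈? I) ×-dec ¬? (g ∈? D))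
... | yes (g , g∈I , g∉D) = inj₂ (g , g∈I , g∉D)
... | no none = inj₁ λ {g} g∈I → decidable-stable (g ∈? D) (λ g∉D → none (g , g∈I , g∉D))

⊆-remove : ∀ {n} {D I : Subset n} {g} → D ⊆ I → g ∉ D → D ⊆ I - g
⊆-remove D⊆I g∉D i∈D = x∈p∧x≢y⇒x∈p-y (D⊆I i∈D) λ { refl → g∉D i∈D }

removal-induction : ∀ {n} (P : Subset n → Set) →
  (∀ X → (∀ f → f ∈ X → P (X - f)) → P X) → ∀ X → P X
removal-induction P step X = go (suc ∣ X ∣) X (n<1+n ∣ X ∣)
  where
  go : ∀ k X → ∣ X ∣ < k → P X
  go (suc k) X (s≤s ∣X∣≤k) =
    step X λ f f∈X → go k (X - f) (<-≤-trans (x∈p⇒∣p-x∣<∣p∣ f∈X) ∣X∣≤k)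

module MatroidRank {n : ℕ} (M : RankFn n) (isM : IsMatroid M) where
  open IsMatroid isM

  rank-∪-≤ : ∀ {X Y} → X ⊆ E M → Y ⊆ E M → r M (X ∪ Y) ≤ r M X + r M Y
  rank-∪-≤ {X} {Y} X⊆E Y⊆E = ≤-trans (m≤m+n _ _) (r-submod X Y X⊆E Y⊆E)

  rank-singleton-≤ : ∀ {X y} → X ⊆ E M → y ∈ E M → r M ⁅ y ⁆ ≤ r M (X ∪ ⁅ y ⁆)
  rank-singleton-≤ X⊆E y∈E = r-mono _ _ (∪⁅⁆-⊆ X⊆E y∈E) (q⊆p∪q _ _)

  rank-add-≥ : ∀ {X e} → X ⊆ E M → e ∈ E M → r M X ≤ r M (X ∪ ⁅ e ⁆)
  rank-add-≥ {X} {e} X⊆E e∈E = r-mono X (X ∪ ⁅ e ⁆) (∪⁅⁆-⊆ X⊆E e∈E) (p⊆p∪q _)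

  rank-singleton-≤1 : ∀ {e} → e ∈ E M → r M ⁅ e ⁆ ≤ 1
  rank-singleton-≤1 {e} e∈E = ≤-trans (r-bound ⁅ e ⁆ (⁅⁆-⊆ e∈E)) (≤-reflexive (∣⁅x⁆∣≡1 e))

  rank-add-≤ : ∀ {X e} → X ⊆ E M → e ∈ E M → r M (X ∪ ⁅ e ⁆) ≤ suc (r M X)
  rank-add-≤ {X} {e} X⊆E e∈E = begin
    r M (X ∪ ⁅ e ⁆)     ≤⟨ rank-∪-≤ X⊆E (⁅⁆-⊆ e∈E) ⟩
    r M X + r M ⁅ e ⁆   ≤⟨ +-mono-≤ (≤-refl {r M X}) (rank-singleton-≤1 e∈E) ⟩
    r M X + 1           ≡⟨ +-comm (r M X) 1 ⟩
    suc (r M X)         ∎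
    where open ≤-Reasoning

  rank-add-≢ : ∀ {X e} → X ⊆ E M → e ∈ E M → r M (X ∪ ⁅ e ⁆) ≢ r M X →
               r M (X ∪ ⁅ e ⁆) ≡ suc (r M X)
  rank-add-≢ X⊆E e∈E ≢ =
    ≤-antisym (rank-add-≤ X⊆E e∈E) (≤∧≢⇒< (rank-add-≥ X⊆E e∈E) (λ eq → ≢ (sym eq)))

  -- Submodularity applied to X - g and a subset Y of X containing g:
  -- removing g costs Y at least as much rank as it costs X.
  submod-remove : ∀ {X Y g} → Y ⊆ X → X ⊆ E M → g ∈ Y →
                  r M X + r M (Y - g) ≤ r M (X - g) + r M Y
  submod-remove {X} {Y} {g} Y⊆X X⊆E g∈Y =
    subst₂ (λ U V → r M U + r M V ≤ r M (X - g) + r M Y)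
           (remove-∪-sub Y⊆X g∈Y) (remove-∩-sub Y⊆X)
           (r-submod (X - g) Y (⊆-trans (p─q⊆p X _) X⊆E) (⊆-trans Y⊆X X⊆E))

  coloop-hereditary : ∀ {X Y g} → Y ⊆ X → X ⊆ E M → g ∈ Y →
                      r M (X - g) < r M X → r M (Y - g) < r M Y
  coloop-hereditary {X} {Y} {g} Y⊆X X⊆E g∈Y coloop =
    +-cancelˡ-< (r M X) (r M (Y - g)) (r M Y)
      (≤-<-trans (submod-remove Y⊆X X⊆E g∈Y) (+-monoˡ-< (r M Y) coloop))

  -- Removing an element keeps a set independent, since it lowers the
  -- rank by at most one ...
  independent-remove : ∀ {X f} → X ⊆ E M → f ∈ X → IsIndependent M X →
                       IsIndependent M (X - f)
  independent-remove {X} {f} X⊆E f∈X indep =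
    ≤-antisym (r-bound (X - f) X-f⊆E) (≤-pred (begin
      suc ∣ X - f ∣              ≡⟨ ∣-∣ f∈X ⟩
      ∣ X ∣                      ≡⟨ sym indep ⟩
      r M X                      ≡⟨ cong (r M) (sym (add-removed f∈X)) ⟩
      r M ((X - f) ∪ ⁅ f ⁆)      ≤⟨ rank-add-≤ X-f⊆E (X⊆E f∈X) ⟩
      suc (r M (X - f))          ∎))
    where
    open ≤-Reasoning
    X-f⊆E : X - f ⊆ E M
    X-f⊆E = ⊆-trans (p─q⊆p X _) X⊆E

  independent-⊆ : ∀ {D} I → D ⊆ I → I ⊆ E M → IsIndependent M I → IsIndependent M D
  independent-⊆ {D} = removal-induction P step
    where
    P : Subset n → Set
    P I = D ⊆ I → I ⊆ E M → IsIndependent M I → IsIndependent M D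
    step : ∀ I → (∀ g → g ∈ I → P (I - g)) → P I
    step I ih D⊆I I⊆E indep with ⊆-or-missing D I
    ... | inj₁ I⊆D = subst (IsIndependent M) (⊆-antisym I⊆D D⊆I) indep
    ... | inj₂ (g , g∈I , g∉D) =
      ih g g∈I (⊆-remove D⊆I g∉D) (⊆-trans (p─q⊆p I _) I⊆E) (independent-remove I⊆E g∈I indep)

  independent-if-coloops : ∀ X → X ⊆ E M → (∀ f → f ∈ X → r M (X - f) < r M X) →
                           IsIndependent M X
  independent-if-coloops = removal-induction P step
    where
    P : Subset n → Set
    P X = X ⊆ E M → (∀ f → f ∈ X → r M (X - f) < r M X) → IsIndependent M X
    step : ∀ X → (∀ f → f ∈ X → P (X - f)) → P X
    step X ih X⊆E coloops with nonempty? X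
    ... | no empty rewrite Empty-unique empty = trans (n≤0⇒n≡0 r∅≤0) (sym (∣⊥∣≡0 n))
      where
      r∅≤0 : r M ∅ ≤ 0
      r∅≤0 = ≤-trans (r-bound ∅ (λ x∈∅ → contradiction x∈∅ ∉⊥)) (≤-reflexive (∣⊥∣≡0 n))
    ... | yes (f , f∈X) = ≤-antisym (r-bound X X⊆E) (begin
      ∣ X ∣                ≡⟨ sym (∣-∣ f∈X) ⟩
      suc ∣ X - f ∣        ≡⟨ cong suc (sym indep) ⟩
      suc (r M (X - f))    ≤⟨ coloops f f∈X ⟩
      r M X                ∎)
      where
      open ≤-Reasoning
      indep : IsIndependent M (X - f)
      indep = ih f f∈X (⊆-trans (p─q⊆p X _) X⊆E) λ g g∈ →
        coloop-hereditary (p─q⊆p X _) X⊆E g∈ (coloops g (proj₁ (∈-remove⁻ g∈)))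

  circuit-by-deletions : ∀ {C} → C ⊆ E M → r M C < ∣ C ∣ →
                         (∀ g → g ∈ C → IsIndependent M (C - g)) → IsCircuit M C
  circuit-by-deletions {C} C⊆E dependent deletions = C⊆E , dependent , proper
    where
    proper : ∀ D → D ⊆ C → D ≢ C → IsIndependent M D
    proper D D⊆C D≢C with ⊆-or-missing D C
    ... | inj₁ C⊆D = contradiction (⊆-antisym D⊆C C⊆D) D≢C
    ... | inj₂ (g , g∈C , g∉D) =
      independent-⊆ (C - g) (⊆-remove D⊆C g∉D) (⊆-trans (p─q⊆p C _) C⊆E) (deletions g g∈C)

  -- Shrink X while e stays spanned; once no element of X
  -- can be dropped, X is independent and X ∪ e is itself a circuit.
  fundamental-circuit : ∀ {e} → e ∈ E M → ∀ X → X ⊆ E M → e ∉ X →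
    r M (X ∪ ⁅ e ⁆) ≡ r M X → ∃ λ C → IsCircuit M C × e ∈ C × C ⊆ X ∪ ⁅ e ⁆
  fundamental-circuit {e} e∈E = removal-induction P step
    where
    P : Subset n → Set
    P X = X ⊆ E M → e ∉ X → r M (X ∪ ⁅ e ⁆) ≡ r M X →
          ∃ λ C → IsCircuit M C × e ∈ C × C ⊆ X ∪ ⁅ e ⁆
    step : ∀ X → (∀ f → f ∈ X → P (X - f)) → P X
    step X ih X⊆E e∉X spans
      with any? (λ f → (f ∈? X) ×-dec (r M ((X - f) ∪ ⁅ e ⁆) ≟ r M (X - f)))
    ... | yes (f , f∈X , spans′) =
      let (C , circuit , e∈C , C⊆) = ih f f∈X (⊆-trans (p─q⊆p X _) X⊆E)
                                         (λ e∈ → e∉X (proj₁ (∈-remove⁻ e∈))) spans′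
      in C , circuit , e∈C , ⊆-trans C⊆ (∪⁅⁆-mono e (p─q⊆p X _))
    ... | no minimal =
      X ∪ ⁅ e ⁆ , circuit-by-deletions X∪e⊆E dependent deletions , e∈X∪⁅e⁆ X e , ⊆-refl
      where
      open ≤-Reasoning
      X∪e⊆E : X ∪ ⁅ e ⁆ ⊆ E M
      X∪e⊆E = ∪⁅⁆-⊆ X⊆E e∈E
      X-f⊆E : ∀ f → X - f ⊆ E M
      X-f⊆E f = ⊆-trans (p─q⊆p X _) X⊆E
      raises : ∀ f → f ∈ X → r M ((X - f) ∪ ⁅ e ⁆) ≡ suc (r M (X - f))
      raises f f∈X = rank-add-≢ (X-f⊆E f) e∈E (λ spans′ → minimal (f , f∈X , spans′))
      indep : IsIndependent M X
      indep = independent-if-coloops X X⊆E λ f f∈X → begin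
        suc (r M (X - f))          ≡⟨ sym (raises f f∈X) ⟩
        r M ((X - f) ∪ ⁅ e ⁆)      ≤⟨ r-mono _ _ X∪e⊆E (∪⁅⁆-mono e (p─q⊆p X _)) ⟩
        r M (X ∪ ⁅ e ⁆)            ≡⟨ spans ⟩
        r M X                      ∎
      dependent : r M (X ∪ ⁅ e ⁆) < ∣ X ∪ ⁅ e ⁆ ∣
      dependent = begin-strict
        r M (X ∪ ⁅ e ⁆)   ≡⟨ trans spans indep ⟩
        ∣ X ∣             <⟨ n<1+n ∣ X ∣ ⟩
        suc ∣ X ∣         ≡⟨ sym (∣∪⁅⁆∣ X e e∉X) ⟩
        ∣ X ∪ ⁅ e ⁆ ∣     ∎
      deletions : ∀ g → g ∈ X ∪ ⁅ e ⁆ → IsIndependent M ((X ∪ ⁅ e ⁆) - g)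
      deletions g g∈ with g ≟ᶠ e
      ... | yes refl = subst (IsIndependent M) (sym (remove-added e∉X)) indep
      ... | no g≢e rewrite remove-past-added {X = X} g≢e = begin-equality
        r M ((X - g) ∪ ⁅ e ⁆)    ≡⟨ raises g g∈X ⟩
        suc (r M (X - g))        ≡⟨ cong suc (independent-remove X⊆E g∈X indep) ⟩
        suc ∣ X - g ∣            ≡⟨ sym (∣∪⁅⁆∣ (X - g) e (λ e∈ → e∉X (proj₁ (∈-remove⁻ e∈)))) ⟩
        ∣ (X - g) ∪ ⁅ e ⁆ ∣      ∎
        where
        g∈X : g ∈ X
        g∈X = ∈-∪⁅⁆⁻ g∈ g≢e

  cyclic⇒stable : ∀ {X} → X ⊆ E M → IsCyclic M X → ∀ f → f ∈ X → r M (X - f) ≡ r M X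
  cyclic⇒stable {X} X⊆E cyclic f f∈X with cyclic f f∈X
  ... | C , (C⊆E , dependent , proper) , f∈C , C⊆X =
    ≤-antisym (r-mono (X - f) X X⊆E (p─q⊆p X _))
              (+-cancelʳ-≤ (r M (C - f)) (r M X) (r M (X - f)) (begin
                r M X + r M (C - f)      ≤⟨ submod-remove C⊆X X⊆E f∈C ⟩
                r M (X - f) + r M C      ≤⟨ +-mono-≤ (≤-refl {r M (X - f)}) rC≤rC-f ⟩
                r M (X - f) + r M (C - f) ∎))
    where
    open ≤-Reasoning
    C-f-indep : IsIndependent M (C - f)
    C-f-indep = proper (C - f) (p─q⊆p C _) λ C-f≡C → f∉X-f C f (subst (f ∈_) (sym C-f≡C) f∈C)
    rC≤rC-f : r M C ≤ r M (C - f)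
    rC≤rC-f = ≤-pred (begin-strict
      r M C               <⟨ dependent ⟩
      ∣ C ∣               ≡⟨ sym (∣-∣ f∈C) ⟩
      suc ∣ C - f ∣       ≡⟨ cong suc (sym C-f-indep) ⟩
      suc (r M (C - f))   ∎)

  stable⇒cyclic : ∀ {X} → X ⊆ E M → (∀ f → f ∈ X → r M (X - f) ≡ r M X) → IsCyclic M X
  stable⇒cyclic {X} X⊆E stable f f∈X =
    let (C , circuit , f∈C , C⊆) = fundamental-circuit (X⊆E f∈X) (X - f)
                                     (⊆-trans (p─q⊆p X _) X⊆E) (f∉X-f X f) spans
    in C , circuit , f∈C , ⊆-trans C⊆ (⊆-reflexive (add-removed f∈X))
    where
    spans : r M ((X - f) ∪ ⁅ f ⁆) ≡ r M (X - f)
    spans = trans (cong (r M) (add-removed f∈X)) (sym (stable f f∈X))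

  cyclic-extension-spans : ∀ {F z} → F ∪ ⁅ z ⁆ ⊆ E M → z ∉ F → IsCyclic M (F ∪ ⁅ z ⁆) →
                           r M (F ∪ ⁅ z ⁆) ≡ r M F
  cyclic-extension-spans {F} {z} F∪z⊆E z∉F cyclic =
    trans (sym (cyclic⇒stable F∪z⊆E cyclic z (e∈X∪⁅e⁆ F z))) (cong (r M) (remove-added z∉F))

  cyclic-extension : ∀ {F z} → F ⊆ E M → z ∈ E M → z ∉ F → r M (F ∪ ⁅ z ⁆) ≡ r M F →
    (∀ f → f ∈ F → r M ((F - f) ∪ ⁅ z ⁆) ≡ r M (F ∪ ⁅ z ⁆)) → IsCyclic M (F ∪ ⁅ z ⁆)
  cyclic-extension {F} {z} F⊆E z∈E z∉F spans stable = stable⇒cyclic (∪⁅⁆-⊆ F⊆E z∈E) stable′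
    where
    stable′ : ∀ g → g ∈ F ∪ ⁅ z ⁆ → r M ((F ∪ ⁅ z ⁆) - g) ≡ r M (F ∪ ⁅ z ⁆)
    stable′ g g∈ with g ≟ᶠ z
    ... | yes refl = trans (cong (r M) (remove-added z∉F)) (sym spans)
    ... | no g≢z = trans (cong (r M) (remove-past-added g≢z)) (stable g (∈-∪⁅⁆⁻ g∈ g≢z))

  flat-cyclic-extension-exclusive : ∀ {F z} → z ∈ E M → z ∉ F →
    ¬ (IsFlat M F × IsCyclic M (F ∪ ⁅ z ⁆))
  flat-cyclic-extension-exclusive z∈E z∉F ((F⊆E , flat) , cyclic) =
    <⇒≱ (flat _ z∈E z∉F)
        (≤-reflexive (cyclic-extension-spans (∪⁅⁆-⊆ F⊆E z∈E) z∉F cyclic))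

  loop-spanned : ∀ {X y} → X ⊆ E M → IsLoop M y → r M (X ∪ ⁅ y ⁆) ≡ r M X
  loop-spanned {X} {y} X⊆E (y∈E , r⁅y⁆≡0) = ≤-antisym (begin
    r M (X ∪ ⁅ y ⁆)     ≤⟨ rank-∪-≤ X⊆E (⁅⁆-⊆ y∈E) ⟩
    r M X + r M ⁅ y ⁆   ≡⟨ cong (r M X +_) r⁅y⁆≡0 ⟩
    r M X + 0           ≡⟨ +-identityʳ (r M X) ⟩
    r M X               ∎) (rank-add-≥ X⊆E y∈E)
    where open ≤-Reasoning

  spanned-stays-spanned : ∀ {F e y} → F ⊆ E M → e ∈ E M → y ∈ E M → e ∉ F → e ≢ y →
    r M (F ∪ ⁅ e ⁆) ≡ r M F → r M ((F ∪ ⁅ e ⁆) ∪ ⁅ y ⁆) ≤ r M (F ∪ ⁅ y ⁆)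
  spanned-stays-spanned {F} {e} {y} F⊆E e∈E y∈E e∉F e≢y spans =
    +-cancelʳ-≤ (r M F) _ _ (begin
      r M X + r M F                              ≡⟨ cong (λ U → r M X + r M U) (sym (remove-added e∉F)) ⟩
      r M X + r M ((F ∪ ⁅ e ⁆) - e)              ≤⟨ submod-remove (p⊆p∪q _) X⊆E (e∈X∪⁅e⁆ F e) ⟩
      r M (X - e) + r M (F ∪ ⁅ e ⁆)              ≡⟨ cong₂ _+_ (cong (r M) X-e≡F∪y) spans ⟩
      r M (F ∪ ⁅ y ⁆) + r M F                    ∎)
    where
    open ≤-Reasoning
    X : Subset n
    X = (F ∪ ⁅ e ⁆) ∪ ⁅ y ⁆
    X⊆E : X ⊆ E M
    X⊆E = ∪⁅⁆-⊆ (∪⁅⁆-⊆ F⊆E e∈E) y∈E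
    X-e≡F∪y : X - e ≡ F ∪ ⁅ y ⁆
    X-e≡F∪y = trans (remove-past-added e≢y) (cong (_∪ ⁅ y ⁆) (remove-added e∉F))

  nullity-add-spanned : ∀ {F z} → F ⊆ E M → z ∉ F → r M (F ∪ ⁅ z ⁆) ≡ r M F →
                        η M F + 1 ≡ η M (F ∪ ⁅ z ⁆)
  nullity-add-spanned {F} {z} F⊆E z∉F spans = begin-equality
    (∣ F ∣ ∸ r M F) + 1          ≡⟨ sym (+-∸-comm 1 (r-bound F F⊆E)) ⟩
    (∣ F ∣ + 1) ∸ r M F          ≡⟨ cong₂ _∸_ (trans (+-comm ∣ F ∣ 1) (sym (∣∪⁅⁆∣ F z z∉F))) (sym spans) ⟩
    ∣ F ∪ ⁅ z ⁆ ∣ ∸ r M (F ∪ ⁅ z ⁆) ∎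
    where open ≤-Reasoning

∸-both-sides-≤ : ∀ {a b d e} c → c ≤ a → c ≤ b → c ≤ d → c ≤ e → a + b ≤ d + e →
                 (a ∸ c) + (b ∸ c) ≤ (d ∸ c) + (e ∸ c)
∸-both-sides-≤ {a} {b} {d} {e} c c≤a c≤b c≤d c≤e a+b≤d+e =
  +-cancelʳ-≤ (c + c) _ _ (begin
    (a ∸ c) + (b ∸ c) + (c + c)      ≡⟨ interchange (a ∸ c) (b ∸ c) c c ⟩
    (a ∸ c + c) + (b ∸ c + c)        ≡⟨ cong₂ _+_ (m∸n+n≡m c≤a) (m∸n+n≡m c≤b) ⟩
    a + b                            ≤⟨ a+b≤d+e ⟩
    d + e                            ≡⟨ sym (cong₂ _+_ (m∸n+n≡m c≤d) (m∸n+n≡m c≤e)) ⟩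
    (d ∸ c + c) + (e ∸ c + c)        ≡⟨ sym (interchange (d ∸ c) (e ∸ c) c c) ⟩
    (d ∸ c) + (e ∸ c) + (c + c)      ∎)
  where open ≤-Reasoning

deletion-matroid : ∀ {n} (M : RankFn n) → IsMatroid M → ∀ x → IsMatroid (M ＼ x)
deletion-matroid M isM x = record
  { r-bound  = λ X X⊆ → r-bound X (⊆-trans X⊆ (p─q⊆p _ _))
  ; r-mono   = λ X Y Y⊆ X⊆Y → r-mono X Y (⊆-trans Y⊆ (p─q⊆p _ _)) X⊆Y
  ; r-submod = λ X Y X⊆ Y⊆ → r-submod X Y (⊆-trans X⊆ (p─q⊆p _ _)) (⊆-trans Y⊆ (p─q⊆p _ _))
  }
  where open IsMatroid isM

contraction-matroid : ∀ {n} (M : RankFn n) → IsMatroid M → ∀ {y} → y ∈ E M → IsMatroid (M ／ y)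
contraction-matroid {n} M isM {y} y∈E = record
  { r-bound  = λ X X⊆ → m≤n+o⇒m∸n≤o (r M (X ∪ ⁅ y ⁆)) (r M ⁅ y ⁆) (begin
      r M (X ∪ ⁅ y ⁆)       ≤⟨ rank-∪-≤ (⊆E X⊆) (⁅⁆-⊆ y∈E) ⟩
      r M X + r M ⁅ y ⁆     ≤⟨ +-mono-≤ (r-bound X (⊆E X⊆)) (≤-refl {r M ⁅ y ⁆}) ⟩
      ∣ X ∣ + r M ⁅ y ⁆     ≡⟨ +-comm ∣ X ∣ _ ⟩
      r M ⁅ y ⁆ + ∣ X ∣     ∎)
  ; r-mono   = λ X Y Y⊆ X⊆Y →
      ∸-monoˡ-≤ (r M ⁅ y ⁆) (r-mono _ _ (∪⁅⁆-⊆ (⊆E Y⊆) y∈E) (∪⁅⁆-mono y X⊆Y))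
  ; r-submod = λ X Y X⊆ Y⊆ →
      ∸-both-sides-≤ (r M ⁅ y ⁆)
        (rank-singleton-≤ (λ i∈ → [ ⊆E X⊆ , ⊆E Y⊆ ]′ (x∈p∪q⁻ X Y i∈)) y∈E)
        (rank-singleton-≤ (⊆-trans (p∩q⊆p X Y) (⊆E X⊆)) y∈E)
        (rank-singleton-≤ (⊆E X⊆) y∈E) (rank-singleton-≤ (⊆E Y⊆) y∈E)
        (subst₂ (λ U V → r M U + r M V ≤ r M (X ∪ ⁅ y ⁆) + r M (Y ∪ ⁅ y ⁆))
                (∪-distribʳ-∪ X Y ⁅ y ⁆) (sym (∪-distribʳ-∩ ⁅ y ⁆ X Y))
                (r-submod _ _ (∪⁅⁆-⊆ (⊆E X⊆) y∈E) (∪⁅⁆-⊆ (⊆E Y⊆) y∈E)))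
  }
  where
  open IsMatroid isM
  open MatroidRank M isM
  open ≤-Reasoning
  ⊆E : ∀ {X} → X ⊆ E M - y → X ⊆ E M
  ⊆E X⊆ = ⊆-trans X⊆ (p─q⊆p _ _)

module ContractionNullity {n : ℕ} (M : RankFn n) (isM : IsMatroid M) {y : Fin n} (y∈E : y ∈ E M)
                          {F : Subset n} (F⊆E : F ⊆ E M) (y∉F : y ∉ F) where
  open MatroidRank M isM

  -- A non-loop y has rank one, so contracting it trades the element y for
  -- one unit of rank.
  nonloop : ¬ IsLoop M y → η (M ／ y) F ≡ η M (F ∪ ⁅ y ⁆)
  nonloop ¬loop = begin
    ∣ F ∣ ∸ (r M (F ∪ ⁅ y ⁆) ∸ r M ⁅ y ⁆)   ≡⟨ cong (λ k → ∣ F ∣ ∸ (r M (F ∪ ⁅ y ⁆) ∸ k)) r⁅y⁆≡1 ⟩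
    ∣ F ∣ ∸ (r M (F ∪ ⁅ y ⁆) ∸ 1)          ≡⟨ ∸-∸1 ∣ F ∣ 1≤r ⟩
    suc ∣ F ∣ ∸ r M (F ∪ ⁅ y ⁆)            ≡⟨ cong (_∸ r M (F ∪ ⁅ y ⁆)) (sym (∣∪⁅⁆∣ F y y∉F)) ⟩
    ∣ F ∪ ⁅ y ⁆ ∣ ∸ r M (F ∪ ⁅ y ⁆)        ∎
    where
    open ≡-Reasoning
    r⁅y⁆≡1 : r M ⁅ y ⁆ ≡ 1
    r⁅y⁆≡1 = ≤-antisym (rank-singleton-≤1 y∈E) (n≢0⇒n>0 λ r≡0 → ¬loop (y∈E , r≡0))
    1≤r : 1 ≤ r M (F ∪ ⁅ y ⁆)
    1≤r = ≤-trans (≤-reflexive (sym r⁅y⁆≡1)) (rank-singleton-≤ F⊆E y∈E)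
    ∸-∸1 : ∀ a {k} → 1 ≤ k → a ∸ (k ∸ 1) ≡ suc a ∸ k
    ∸-∸1 a {suc k} _ = refl

  -- A loop y is spanned by F, so in M ／ y the set F keeps its M-nullity,
  -- one less than that of F ∪ y.
  loop : IsLoop M y → η (M ／ y) F + 1 ≡ η M (F ∪ ⁅ y ⁆)
  loop isLoop@(_ , r⁅y⁆≡0) = begin
    η (M ／ y) F + 1   ≡⟨ cong (λ k → ∣ F ∣ ∸ k + 1) (trans (cong (r M (F ∪ ⁅ y ⁆) ∸_) r⁅y⁆≡0) spans) ⟩
    η M F + 1          ≡⟨ nullity-add-spanned F⊆E y∉F spans ⟩
    η M (F ∪ ⁅ y ⁆)    ∎
    where
    open ≡-Reasoning
    spans : r M (F ∪ ⁅ y ⁆) ≡ r M F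
    spans = loop-spanned F⊆E isLoop

module _ {n : ℕ} (M : RankFn n) {X : Subset n} where

  private
    lookup-cl : ∀ i → lookup (cl M X) i ≡ does (i ∈? E M) B.∧ does (r M (X ∪ ⁅ i ⁆) ≟ r M X)
    lookup-cl = lookup∘tabulate _

  ∈-cl⁻ : ∀ {i} → i ∈ cl M X → i ∈ E M × r M (X ∪ ⁅ i ⁆) ≡ r M X
  ∈-cl⁻ {i} i∈cl = decode (i ∈? E M) (_ ≟ _) (trans (sym (lookup-cl i)) ([]=⇒lookup i∈cl))
    where
    decode : (p : Dec (i ∈ E M)) (q : Dec (r M (X ∪ ⁅ i ⁆) ≡ r M X)) →
             does p B.∧ does q ≡ true → i ∈ E M × r M (X ∪ ⁅ i ⁆) ≡ r M X
    decode (yes i∈E) (yes spans) _ = i∈E , spans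
    decode (yes _)   (no _)     ()
    decode (no _)    _          ()

  ∈-cl⁺ : ∀ {i} → i ∈ E M → r M (X ∪ ⁅ i ⁆) ≡ r M X → i ∈ cl M X
  ∈-cl⁺ {i} i∈E spans = lookup⇒[]= i (cl M X)
    (trans (lookup-cl i) (cong₂ B._∧_ (dec-true (i ∈? E M) i∈E) (dec-true (_ ≟ _) spans)))

Lifts : ∀ {n} → RankFn n → RankFn n → Fin n → Subset n → Set
Lifts N M z F = (IsCyclicFlat M F × η N F ≤ η M F)
              ⊎ (IsCyclicFlat M (F ∪ ⁅ z ⁆) × η N F ≤ η M (F ∪ ⁅ z ⁆))

-- Part (1): cyclic flats of M ＼ x.  According as x is spanned by F or
-- not, F ∪ x or F is a cyclic flat of M, and it is the closure of F.
module Deletion {n : ℕ} (M : RankFn n) (isM : IsMatroid M) {x : Fin n} (x∈E : x ∈ E M)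
                {F : Subset n} (cf : IsCyclicFlat (M ＼ x) F) where
  open IsMatroid isM
  open MatroidRank M isM

  F⊆E : F ⊆ E M
  F⊆E = ⊆-trans (proj₁ (proj₁ cf)) (p─q⊆p _ _)

  x∉F : x ∉ F
  x∉F x∈F = f∉X-f (E M) x (proj₁ (proj₁ cf) x∈F)

  flat-off-x : ∀ e → e ∈ E M → e ∉ F → e ≢ x → r M F < r M (F ∪ ⁅ e ⁆)
  flat-off-x e e∈E e∉F e≢x = proj₂ (proj₁ cf) e (x∈p∧x≢y⇒x∈p-y e∈E e≢x) e∉F

  -- Circuits of M ＼ x are circuits of M, so F is cyclic in M.
  stable : ∀ f → f ∈ F → r M (F - f) ≡ r M F
  stable = cyclic⇒stable F⊆E λ e e∈F →
    let (C , (C⊆ , dependent , proper) , e∈C , C⊆F) = proj₂ cf e e∈F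
    in C , (⊆-trans C⊆ (p─q⊆p _ _) , dependent , proper) , e∈C , C⊆F

  unspanned : r M (F ∪ ⁅ x ⁆) ≢ r M F → IsCyclicFlat M F
  unspanned ≢ = (F⊆E , flat) , stable⇒cyclic F⊆E stable
    where
    flat : ∀ e → e ∈ E M → e ∉ F → r M F < r M (F ∪ ⁅ e ⁆)
    flat e e∈E e∉F with e ≟ᶠ x
    ... | yes refl = ≤∧≢⇒< (rank-add-≥ F⊆E e∈E) (λ eq → ≢ (sym eq))
    ... | no e≢x = flat-off-x e e∈E e∉F e≢x

  spanned : r M (F ∪ ⁅ x ⁆) ≡ r M F → IsCyclicFlat M (F ∪ ⁅ x ⁆)
  spanned spans = (F∪x⊆E , flat) , cyclic-extension F⊆E x∈E x∉F spans stable′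
    where
    open ≤-Reasoning
    F∪x⊆E : F ∪ ⁅ x ⁆ ⊆ E M
    F∪x⊆E = ∪⁅⁆-⊆ F⊆E x∈E
    flat : ∀ e → e ∈ E M → e ∉ F ∪ ⁅ x ⁆ → r M (F ∪ ⁅ x ⁆) < r M ((F ∪ ⁅ x ⁆) ∪ ⁅ e ⁆)
    flat e e∈E e∉ = begin-strict
      r M (F ∪ ⁅ x ⁆)              ≡⟨ spans ⟩
      r M F                        <⟨ flat-off-x e e∈E (e∉ ∘ p⊆p∪q _) (λ { refl → e∉ (e∈X∪⁅e⁆ F e) }) ⟩
      r M (F ∪ ⁅ e ⁆)              ≤⟨ r-mono _ _ (∪⁅⁆-⊆ F∪x⊆E e∈E) (∪⁅⁆-mono e (p⊆p∪q _)) ⟩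
      r M ((F ∪ ⁅ x ⁆) ∪ ⁅ e ⁆)    ∎
    stable′ : ∀ f → f ∈ F → r M ((F - f) ∪ ⁅ x ⁆) ≡ r M (F ∪ ⁅ x ⁆)
    stable′ f f∈F = ≤-antisym (r-mono _ _ F∪x⊆E (∪⁅⁆-mono x (p─q⊆p F _))) (begin
      r M (F ∪ ⁅ x ⁆)          ≡⟨ trans spans (sym (stable f f∈F)) ⟩
      r M (F - f)              ≤⟨ rank-add-≥ (⊆-trans (p─q⊆p F _) F⊆E) x∈E ⟩
      r M ((F - f) ∪ ⁅ x ⁆)    ∎)

  F⊆cl : F ⊆ cl M F
  F⊆cl i∈F = ∈-cl⁺ M (F⊆E i∈F) (cong (r M) (∪⁅⁆-absorb i∈F))

  cl⊆F∪x : cl M F ⊆ F ∪ ⁅ x ⁆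
  cl⊆F∪x {i} i∈cl with ∈-cl⁻ M i∈cl | i ≟ᶠ x | i ∈? F
  ... | _            | yes refl | _      = e∈X∪⁅e⁆ F i
  ... | _            | no _     | yes i∈F = p⊆p∪q _ i∈F
  ... | i∈E , spans  | no i≢x   | no i∉F  =
    contradiction (flat-off-x i i∈E i∉F i≢x) (λ lt → <⇒≱ lt (≤-reflexive spans))

  closure-cyclic-flat : IsCyclicFlat M (cl M F)
  closure-cyclic-flat with r M (F ∪ ⁅ x ⁆) ≟ r M F
  ... | yes spans = subst (IsCyclicFlat M) (sym cl≡F∪x) (spanned spans)
    where
    cl≡F∪x : cl M F ≡ F ∪ ⁅ x ⁆
    cl≡F∪x = ⊆-antisym cl⊆F∪x (∪⁅⁆-⊆ F⊆cl (∈-cl⁺ M x∈E spans))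
  ... | no ≢ = subst (IsCyclicFlat M) (sym cl≡F) (unspanned ≢)
    where
    cl≡F : cl M F ≡ F
    cl≡F = ⊆-antisym (λ i∈cl → ∈-∪⁅⁆⁻ (cl⊆F∪x i∈cl) λ { refl → ≢ (proj₂ (∈-cl⁻ M i∈cl)) }) F⊆cl

  closure-nullity : cl M F ≡ F ∪ ⁅ x ⁆ → η (M ＼ x) F + 1 ≡ η M (F ∪ ⁅ x ⁆)
  closure-nullity cl≡F∪x = nullity-add-spanned F⊆E x∉F
    (proj₂ (∈-cl⁻ M (subst (x ∈_) (sym cl≡F∪x) (e∈X∪⁅e⁆ F x))))

  lift : Lifts (M ＼ x) M x F
  lift with r M (F ∪ ⁅ x ⁆) ≟ r M F
  ... | yes spans = inj₂ (spanned spans ,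
          ≤-trans (m≤m+n (η M F) 1) (≤-reflexive (nullity-add-spanned F⊆E x∉F spans)))
  ... | no ≢ = inj₁ (unspanned ≢ , ≤-refl)

-- Part (2): cyclic flats of M ／ y.  According as y is spanned by F or
-- not, F ∪ y or F is a cyclic flat of M, and never both.
module Contraction {n : ℕ} (M : RankFn n) (isM : IsMatroid M) {y : Fin n} (y∈E : y ∈ E M)
                   {F : Subset n} (cf : IsCyclicFlat (M ／ y) F) where
  open IsMatroid isM
  open MatroidRank M isM
  module M／y = MatroidRank (M ／ y) (contraction-matroid M isM y∈E)

  F⊆E : F ⊆ E M
  F⊆E = ⊆-trans (proj₁ (proj₁ cf)) (p─q⊆p _ _)

  y∉F : y ∉ F
  y∉F y∈F = f∉X-f (E M) y (proj₁ (proj₁ cf) y∈F)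

  flat-with-y : ∀ e → e ∈ E M → e ∉ F → e ≢ y → r M (F ∪ ⁅ y ⁆) < r M ((F ∪ ⁅ e ⁆) ∪ ⁅ y ⁆)
  flat-with-y e e∈E e∉F e≢y = ≰⇒> λ ≥ →
    <⇒≱ (proj₂ (proj₁ cf) e (x∈p∧x≢y⇒x∈p-y e∈E e≢y) e∉F) (∸-monoˡ-≤ (r M ⁅ y ⁆) ≥)

  stable-with-y : ∀ f → f ∈ F → r M ((F - f) ∪ ⁅ y ⁆) ≡ r M (F ∪ ⁅ y ⁆)
  stable-with-y f f∈F = ∸-cancelʳ-≡ (rank-singleton-≤ (⊆-trans (p─q⊆p F _) F⊆E) y∈E)
                                    (rank-singleton-≤ F⊆E y∈E)
    (M／y.cyclic⇒stable (proj₁ (proj₁ cf)) (proj₂ cf) f f∈F)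

  spanned : r M (F ∪ ⁅ y ⁆) ≡ r M F → IsCyclicFlat M (F ∪ ⁅ y ⁆)
  spanned spans = (∪⁅⁆-⊆ F⊆E y∈E , flat) , cyclic-extension F⊆E y∈E y∉F spans stable-with-y
    where
    flat : ∀ e → e ∈ E M → e ∉ F ∪ ⁅ y ⁆ → r M (F ∪ ⁅ y ⁆) < r M ((F ∪ ⁅ y ⁆) ∪ ⁅ e ⁆)
    flat e e∈E e∉ = subst (λ U → r M (F ∪ ⁅ y ⁆) < r M U) (∪-swapʳ F ⁅ e ⁆ ⁅ y ⁆)
      (flat-with-y e e∈E (e∉ ∘ p⊆p∪q _) (λ { refl → e∉ (e∈X∪⁅e⁆ F e) }))

  unspanned : r M (F ∪ ⁅ y ⁆) ≢ r M F → IsCyclicFlat M F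
  unspanned ≢ = (F⊆E , flat) , stable⇒cyclic F⊆E stable
    where
    open ≤-Reasoning
    raises : r M (F ∪ ⁅ y ⁆) ≡ suc (r M F)
    raises = rank-add-≢ F⊆E y∈E ≢
    -- an element e ≠ y spanned by F would stay spanned by F ∪ y,
    -- contradicting flatness of F in M ／ y
    flat : ∀ e → e ∈ E M → e ∉ F → r M F < r M (F ∪ ⁅ e ⁆)
    flat e e∈E e∉F with e ≟ᶠ y | r M (F ∪ ⁅ e ⁆) ≟ r M F
    ... | yes refl | _        = ≤-reflexive (sym raises)
    ... | no _     | no ≢e    = ≤-reflexive (sym (rank-add-≢ F⊆E e∈E ≢e))
    ... | no e≢y   | yes spans =
      contradiction (flat-with-y e e∈E e∉F e≢y)
                    (≤⇒≯ (spanned-stays-spanned F⊆E e∈E y∈E e∉F e≢y spans))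
    stable : ∀ f → f ∈ F → r M (F - f) ≡ r M F
    stable f f∈F = ≤-antisym (r-mono _ _ F⊆E (p─q⊆p F _)) (≤-pred (begin
      suc (r M F)                 ≡⟨ sym raises ⟩
      r M (F ∪ ⁅ y ⁆)             ≡⟨ sym (stable-with-y f f∈F) ⟩
      r M ((F - f) ∪ ⁅ y ⁆)       ≤⟨ rank-add-≤ (⊆-trans (p─q⊆p F _) F⊆E) y∈E ⟩
      suc (r M (F - f))           ∎))

  one-of : IsCyclicFlat M F ⊎ IsCyclicFlat M (F ∪ ⁅ y ⁆)
  one-of with r M (F ∪ ⁅ y ⁆) ≟ r M F
  ... | yes spans = inj₂ (spanned spans)
  ... | no ≢ = inj₁ (unspanned ≢)

  not-both : ¬ (IsCyclicFlat M F × IsCyclicFlat M (F ∪ ⁅ y ⁆))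
  not-both ((flatF , _) , (_ , cyclicF∪y)) =
    flat-cyclic-extension-exclusive y∈E y∉F (flatF , cyclicF∪y)

  open ContractionNullity M isM y∈E F⊆E y∉F public

  flat-raises : IsCyclicFlat M F → r M (F ∪ ⁅ y ⁆) ≡ suc (r M F)
  flat-raises ((_ , flat) , _) = ≤-antisym (rank-add-≤ F⊆E y∈E) (flat y y∈E y∉F)

  flat-nonloop : IsCyclicFlat M F → ¬ IsLoop M y
  flat-nonloop cfF isLoop = 1+n≢n (trans (sym (flat-raises cfF)) (loop-spanned F⊆E isLoop))

  nullity-F : IsCyclicFlat M F → η (M ／ y) F ≡ η M F
  nullity-F cfF = begin
    η (M ／ y) F                  ≡⟨ nonloop (flat-nonloop cfF) ⟩
    η M (F ∪ ⁅ y ⁆)               ≡⟨ cong (∣ F ∪ ⁅ y ⁆ ∣ ∸_) (flat-raises cfF) ⟩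
    ∣ F ∪ ⁅ y ⁆ ∣ ∸ suc (r M F)   ≡⟨ cong (_∸ suc (r M F)) (∣∪⁅⁆∣ F y y∉F) ⟩
    η M F                         ∎
    where open ≡-Reasoning

  lift : Lifts (M ／ y) M y F
  lift with one-of
  ... | inj₁ cfF = inj₁ (cfF , ≤-reflexive (nullity-F cfF))
  ... | inj₂ cfF∪y with r M ⁅ y ⁆ ≟ 0
  ...   | yes r≡0 = inj₂ (cfF∪y , ≤-trans (m≤m+n _ 1) (≤-reflexive (loop (y∈E , r≡0))))
  ...   | no r≢0  = inj₂ (cfF∪y , ≤-reflexive (nonloop (r≢0 ∘ proj₂)))

sum-mono : ∀ {n} (f g : Subset n → ℕ) → (∀ X → f X ≤ g X) → sumSubsets f ≤ sumSubsets g
sum-mono {zero}  f g f≤g = f≤g []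
sum-mono {suc n} f g f≤g =
  +-mono-≤ (sum-mono _ _ (λ X → f≤g (outside ∷ X))) (sum-mono _ _ (λ X → f≤g (inside ∷ X)))

sum-+ : ∀ {n} (f g : Subset n → ℕ) →
        sumSubsets (λ X → f X + g X) ≡ sumSubsets f + sumSubsets g
sum-+ {zero}  f g = refl
sum-+ {suc n} f g = trans
  (cong₂ _+_ (sum-+ (λ X → f (outside ∷ X)) (λ X → g (outside ∷ X)))
             (sum-+ (λ X → f (inside ∷ X)) (λ X → g (inside ∷ X))))
  (interchange (sumSubsets (λ X → f (outside ∷ X))) (sumSubsets (λ X → g (outside ∷ X)))
               (sumSubsets (λ X → f (inside ∷ X))) (sumSubsets (λ X → g (inside ∷ X))))

sum-zero : ∀ {n} (f : Subset n → ℕ) → (∀ X → f X ≡ 0) → sumSubsets f ≡ 0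
sum-zero {zero}  f f≡0 = f≡0 []
sum-zero {suc n} f f≡0 =
  cong₂ _+_ (sum-zero _ (λ X → f≡0 (outside ∷ X))) (sum-zero _ (λ X → f≡0 (inside ∷ X)))

sum-paired : ∀ {n} (z : Fin n) (f g : Subset n → ℕ) →
  (∀ F → z ∈ F → f F ≡ 0) → (∀ F → z ∉ F → f F ≤ g F + g (F ∪ ⁅ z ⁆)) →
  sumSubsets f ≤ sumSubsets g
sum-paired {suc n} zero f g vanish bound = begin
  sumSubsets (λ X → f (outside ∷ X)) + sumSubsets (λ X → f (inside ∷ X))
    ≡⟨ cong (sumSubsets (λ X → f (outside ∷ X)) +_) (sum-zero _ (λ X → vanish (inside ∷ X) here)) ⟩
  sumSubsets (λ X → f (outside ∷ X)) + 0
    ≡⟨ +-identityʳ _ ⟩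
  sumSubsets (λ X → f (outside ∷ X))
    ≤⟨ sum-mono _ (λ X → g (outside ∷ X) + g (inside ∷ X)) bound′ ⟩
  sumSubsets (λ X → g (outside ∷ X) + g (inside ∷ X))
    ≡⟨ sum-+ (λ X → g (outside ∷ X)) (λ X → g (inside ∷ X)) ⟩
  sumSubsets (λ X → g (outside ∷ X)) + sumSubsets (λ X → g (inside ∷ X)) ∎
  where
  open ≤-Reasoning
  bound′ : ∀ X → f (outside ∷ X) ≤ g (outside ∷ X) + g (inside ∷ X)
  bound′ X = subst (λ Y → f (outside ∷ X) ≤ g (outside ∷ X) + g (inside ∷ Y))
                   (∪-identityʳ X) (bound (outside ∷ X) λ ())
sum-paired {suc n} (suc z) f g vanish bound =
  +-mono-≤ (sum-paired z (λ X → f (outside ∷ X)) (λ X → g (outside ∷ X))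
              (λ F z∈F → vanish _ (there z∈F)) (λ F z∉F → bound _ λ { (there z∈F) → z∉F z∈F }))
           (sum-paired z (λ X → f (inside ∷ X)) (λ X → g (inside ∷ X))
              (λ F z∈F → vanish _ (there z∈F)) (λ F z∉F → bound _ λ { (there z∈F) → z∉F z∈F }))

ηZ′-term : ∀ {n} → RankFn n → Subset n → ℕ
ηZ′-term M F = if does (isCyclicFlat′? M F) then η M F else 0

module _ {n : ℕ} (M : RankFn n) {F : Subset n} where

  ηZ′-term-≥ : IsCyclicFlat′ M F → η M F ≤ ηZ′-term M F
  ηZ′-term-≥ = select (isCyclicFlat′? M F)
    where
    select : ∀ {P : Set} (p : Dec P) → P → η M F ≤ (if does p then η M F else 0)
    select (yes _) _  = ≤-refl
    select (no ¬p) pf = contradiction pf ¬p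

  ηZ′-term-≤ : ∀ {c} → (IsCyclicFlat′ M F → η M F ≤ c) → ηZ′-term M F ≤ c
  ηZ′-term-≤ {c} = select (isCyclicFlat′? M F)
    where
    select : ∀ {P : Set} (p : Dec P) → (P → η M F ≤ c) → (if does p then η M F else 0) ≤ c
    select (yes pf) bound = bound pf
    select (no _)   _     = z≤n

  ηZ′-term-0 : ¬ IsCyclicFlat′ M F → ηZ′-term M F ≡ 0
  ηZ′-term-0 ¬cf = n≤0⇒n≡0 (ηZ′-term-≤ λ cf → contradiction cf ¬cf)

ηZ′-single-minor : ∀ {n} (N M : RankFn n) {z} → z ∈ E M → E N ≡ E M - z →
  (∀ F → IsCyclicFlat N F → Lifts N M z F) → ηZ′ N ≤ ηZ′ M
ηZ′-single-minor N M {z} z∈E EN≡ lifts = sum-paired z (ηZ′-term N) (ηZ′-term M) vanish bound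
  where
  vanish : ∀ F → z ∈ F → ηZ′-term N F ≡ 0
  vanish F z∈F = ηZ′-term-0 N λ (((F⊆EN , _) , _) , _) →
    f∉X-f (E M) z (subst (z ∈_) EN≡ (F⊆EN z∈F))
  bound : ∀ F → z ∉ F → ηZ′-term N F ≤ ηZ′-term M F + ηZ′-term M (F ∪ ⁅ z ⁆)
  bound F z∉F = ηZ′-term-≤ N λ (cf , F≢∅ , F≢EN) → case-lift F≢∅ F≢EN (lifts F cf)
    where
    case-lift : F ≢ ∅ → F ≢ E N → Lifts N M z F →
                η N F ≤ ηZ′-term M F + ηZ′-term M (F ∪ ⁅ z ⁆)
    case-lift F≢∅ _ (inj₁ (cfM , η≤)) =
      ≤-trans η≤ (≤-trans (ηZ′-term-≥ M (cfM , F≢∅ , F≢E)) (m≤m+n _ _))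
      where
      F≢E : F ≢ E M
      F≢E F≡E = z∉F (subst (z ∈_) (sym F≡E) z∈E)
    case-lift _ F≢EN (inj₂ (cfM , η≤)) =
      ≤-trans η≤ (≤-trans (ηZ′-term-≥ M (cfM , F∪z≢∅ , F∪z≢E)) (m≤n+m _ _))
      where
      F∪z≢∅ : F ∪ ⁅ z ⁆ ≢ ∅
      F∪z≢∅ eq = contradiction (subst (z ∈_) eq (e∈X∪⁅e⁆ F z)) ∉⊥
      F∪z≢E : F ∪ ⁅ z ⁆ ≢ E M
      F∪z≢E eq = F≢EN (trans (sym (remove-added z∉F)) (trans (cong (_- z) eq) (sym EN≡)))

cyclic-flat′-≅ : ∀ {n} {N M : RankFn n} → N ≅ M → ∀ {X} → IsCyclicFlat′ N X →
                 IsCyclicFlat′ M X × η N X ≡ η M X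
cyclic-flat′-≅ {N = mkRankFn E₀ r₁} {mkRankFn .E₀ r₂} (refl , r≡) {X}
               (((X⊆E , flat) , cyclic) , X≢∅ , X≢E) =
  (((X⊆E , flat′) , cyclic′) , X≢∅ , X≢E) , cong (∣ X ∣ ∸_) (r≡ X X⊆E)
  where
  flat′ : ∀ e → e ∈ E₀ → e ∉ X → r₂ X < r₂ (X ∪ ⁅ e ⁆)
  flat′ e e∈E e∉X = subst₂ _<_ (r≡ X X⊆E) (r≡ _ (∪⁅⁆-⊆ X⊆E e∈E)) (flat e e∈E e∉X)
  cyclic′ : IsCyclic (mkRankFn E₀ r₂) X
  cyclic′ e e∈X =
    let (C , (C⊆E , dependent , proper) , e∈C , C⊆X) = cyclic e e∈X
    in C , (C⊆E , subst (_< ∣ C ∣) (r≡ C C⊆E) dependent ,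
            λ D D⊆C D≢C → trans (sym (r≡ D (⊆-trans D⊆C C⊆E))) (proper D D⊆C D≢C)) ,
       e∈C , C⊆X

ηZ′-≅ : ∀ {n} {N M : RankFn n} → N ≅ M → ηZ′ N ≤ ηZ′ M
ηZ′-≅ {N = N} {M} N≅M = sum-mono (ηZ′-term N) (ηZ′-term M) λ X → ηZ′-term-≤ N λ cf →
  let (cfM , η≡) = cyclic-flat′-≅ N≅M cf in ≤-trans (≤-reflexive η≡) (ηZ′-term-≥ M cfM)

ηZ′-minor : ∀ {n} {N M : RankFn n} → IsMatroid M → N ≼ M → ηZ′ N ≤ ηZ′ M
ηZ′-minor isM (minor-refl N≅M) = ηZ′-≅ N≅M
ηZ′-minor {M = M} isM (minor-del x x∈E N≼M＼x) =
  ≤-trans (ηZ′-minor (deletion-matroid M isM x) N≼M＼x)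
          (ηZ′-single-minor (M ＼ x) M x∈E refl λ F cf → Deletion.lift M isM x∈E cf)
ηZ′-minor {M = M} isM (minor-con y y∈E N≼M／y) =
  ≤-trans (ηZ′-minor (contraction-matroid M isM y∈E) N≼M／y)
          (ηZ′-single-minor (M ／ y) M y∈E refl λ F cf → Contraction.lift M isM y∈E cf)

lemma2p2 : ∀ {n : ℕ} (M : RankFn n) → IsMatroid M →
    -- (1) deletion
    (∀ (x : Fin n) → x ∈ E M → ∀ (F : Subset n) → IsCyclicFlat (M ＼ x) F →
      IsCyclicFlat M (cl M F)
      × (cl M F ≡ F → η (M ＼ x) F ≡ η M F)
      × (cl M F ≡ F ∪ ⁅ x ⁆ → η (M ＼ x) F + 1 ≡ η M (F ∪ ⁅ x ⁆)))
    -- (2) contraction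
    × (∀ (y : Fin n) → y ∈ E M → ∀ (F : Subset n) → IsCyclicFlat (M ／ y) F →
      (IsCyclicFlat M F ⊎ IsCyclicFlat M (F ∪ ⁅ y ⁆))
      × ¬ (IsCyclicFlat M F × IsCyclicFlat M (F ∪ ⁅ y ⁆))
      × (¬ IsLoop M y →
          (IsCyclicFlat M F → η (M ／ y) F ≡ η M F)
          × (IsCyclicFlat M (F ∪ ⁅ y ⁆) → η (M ／ y) F ≡ η M (F ∪ ⁅ y ⁆)))
      × (IsLoop M y → η (M ／ y) F + 1 ≡ η M (F ∪ ⁅ y ⁆)))
    -- (3) minors
    × (∀ (N : RankFn n) → N ≼ M → ηZ′ N ≤ ηZ′ M)
lemma2p2 M isM =
  -- (1): deletion does not change the rank function, so nullities agree on F.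
  (λ x x∈E F cf → let open Deletion M isM x∈E cf in
    closure-cyclic-flat , (λ _ → refl) , closure-nullity)
  , (λ y y∈E F cf → let open Contraction M isM y∈E cf in
    one-of , not-both , (λ ¬loop → nullity-F , λ _ → nonloop ¬loop) , loop)
  , λ N N≼M → ηZ′-minor isM N≼M
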